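{- For every positive integer $n$, $$(6n+1)\binom{5n}{n}\ \Big|\ \binom{3n-1}{n-1}C_{3n}^{(4)}\qquad\text{and}\qquad \binom{3n}{n}\ \Big|\ \binom{5n-1}{n-1}C_{5n}^{(2)}.$$
   Context: For $h,m\in\mathbb{N}$, $C_m^{(h)}=\frac{1}{hm+1}\binom{(h+1)m}{m}$ is the generalized Catalan number of order $h$ (an integer); thus $C_{3n}^{(4)}=\binom{15n}{3n}/(12n+1)$ and $C_{5n}^{(2)}=\binom{15n}{5n}/(10n+1)$. -}

module Defs where

open import Data.Nat using (ℕ; suc; _+_; _*_; _/_)
open import Data.Nat.Combinatorics using (_C_)

-- Generalized Catalan number of order h:
--   C_m^{(h)} = (1/(hm+1)) * binom((h+1)m, m)
-- (an integer, so ℕ floor division is exact; hm+1 = suc (h*m) is nonzero).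
catalan : ℕ → ℕ → ℕ
catalan h m = ((suc h * m) C m) / suc (h * m)

module Submission where

open import Defs
open import Data.Nat using (ℕ; suc; _*_; _∸_)
open import Data.Nat.Combinatorics using (_C_)
open import Data.Nat.Divisibility using (_∣_)
open import Data.Product using (_×_)

open import Data.Nat
open import Data.Nat.Properties
open import Data.Nat.Divisibility
open import Data.Nat.DivMod
open import Data.Nat.Combinatorics
open import Data.Nat.Primality
open import Data.Nat.Primality.Factorisation using (factorise; PrimeFactorisation)
open import Data.Nat.Coprimality using (Coprime; coprime?)
open import Data.Nat.ListAction using (sum; product)
open import Data.Nat.ListAction.Properties using (sum-++)
open import Data.Nat.Tactic.RingSolver using (solve-∀)
open import Data.List using (List; []; _∷_; map; _++_)
open import Data.List.Properties using (map-++)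
open import Data.List.Relation.Unary.All as All using (All; []; _∷_)
open import Data.Product using (Σ-syntax; _,_; proj₁; proj₂)
open import Data.Sum using (_⊎_; inj₁; inj₂)
open import Data.Empty using (⊥-elim)
open import Relation.Nullary using (¬_; Dec; yes; no)
open import Relation.Nullary.Decidable using (True; toWitness; from-yes; map′; _→-dec_; _×-dec_)
open import Relation.Binary.PropositionalEquality
open import Algebra.Properties.CommutativeSemigroup *-commutativeSemigroup using (interchange)
open import Algebra.Properties.CommutativeSemigroup +-commutativeSemigroup using () renaming (interchange to +-interchange)

-- Both divisibilities are statements about ratios of
-- factorials and are proved p-adically.
--  * Valuations and Legendre's formula give Landau's criterion: ∏ x! ∣ ∏ y!
--    whenever Σ ⌊x/d⌋ ≤ Σ ⌊y/d⌋ for all d ≥ 2.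
--  * All numerators are of the form kn or kn + 1 with k ∣ 60, so every floor
--    ⌊kn/d⌋ is a function of t = ⌊60n/d⌋, and the floor-sum inequalities reduce
--    to finite computations on one period of t (plus, when d ∣ kn + 1, on the
--    residues of the cofactor); these checks are run by decision procedures.
--  * Landau's criterion yields w·C(5n,n) ∣ 3·C(3n−1,n−1)·C^{(4)}_{3n}, resp.
--    C(3n,n) ∣ 5·C(5n−1,n−1)·C^{(2)}_{5n}, and it shows that the Catalan
--    numbers are exact quotients.  The spurious prime q = 3, resp. 5, is removed
--    using (qk)! = q^k k! U with q ∤ U, which makes C(qa + qb, qa) and
--    C(a + b, a) q-adically equal.

module Valuation (p : ℕ) (p-prime : Prime p) where

  instance
    p≢0 : NonZero p
    p≢0 = prime⇒nonZero p-prime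

  p^i≢0 : ∀ i → NonZero (p ^ i)
  p^i≢0 i = m^n≢0 p i

  1<p : 1 < p
  1<p = nonTrivial⇒n>1 p {{prime⇒nonTrivial p-prime}}

  p∤1 : ¬ p ∣ 1
  p∤1 p∣1 = <⇒≢ 1<p (sym (∣1⇒≡1 p∣1))

  νWithin : ℕ → ℕ → ℕ
  νWithin zero    m = 0
  νWithin (suc f) m with p ∣? m
  ... | yes _ = suc (νWithin f (m / p))
  ... | no  _ = 0

  -- The p-adic valuation; m itself is enough fuel.
  ν : ℕ → ℕ
  ν m = νWithin m m

  factorOut : ∀ f m .{{_ : NonZero m}} → m ≤ f → Σ[ u ∈ ℕ ] (m ≡ p ^ νWithin f m * u) × ¬ p ∣ u
  factorOut zero    (suc m) ()
  factorOut (suc f) m m≤f with p ∣? m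
  ... | no p∤m  = m , sym (*-identityˡ m) , p∤m
  ... | yes p∣m = divideOnce (factorOut f (m / p) {{m/p≢0}} m/p≤f)
    where
    m/p≢0 : NonZero (m / p)
    m/p≢0 = ≢-nonZero λ m/p≡0 → ≢-nonZero⁻¹ m (trans (sym (m/n*n≡m p∣m)) (cong (_* p) m/p≡0))

    m/p≤f : m / p ≤ f
    m/p≤f = ≤-pred (≤-trans (m/n<m m p 1<p) m≤f)

    divideOnce : Σ[ u ∈ ℕ ] (m / p ≡ p ^ νWithin f (m / p) * u) × ¬ p ∣ u →
                 Σ[ u ∈ ℕ ] (m ≡ p ^ suc (νWithin f (m / p)) * u) × ¬ p ∣ u
    divideOnce (u , m/p≡ , p∤u) = u , m≡ , p∤u
      where
      open ≡-Reasoning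
      m≡ : m ≡ p ^ suc (νWithin f (m / p)) * u
      m≡ = begin
        m                                 ≡⟨ m*[n/m]≡n p∣m ⟨
        p * (m / p)                       ≡⟨ cong (p *_) m/p≡ ⟩
        p * (p ^ νWithin f (m / p) * u)   ≡⟨ *-assoc p _ u ⟨
        p ^ suc (νWithin f (m / p)) * u   ∎

  decompose : ∀ m .{{_ : NonZero m}} → Σ[ u ∈ ℕ ] (m ≡ p ^ ν m * u) × ¬ p ∣ u
  decompose m = factorOut m m ≤-refl

  p∣p^[1+e]*u : ∀ e u → p ∣ p ^ suc e * u
  p∣p^[1+e]*u e u = ∣m⇒∣m*n u (m∣m*n (p ^ e))

  exponent-unique : ∀ e e′ u u′ → p ^ e * u ≡ p ^ e′ * u′ → ¬ p ∣ u → ¬ p ∣ u′ → e ≡ e′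
  exponent-unique zero    zero     u u′ eq p∤u p∤u′ = refl
  exponent-unique zero    (suc e′) u u′ eq p∤u p∤u′ =
    ⊥-elim (p∤u (subst (p ∣_) (trans (sym eq) (*-identityˡ u)) (p∣p^[1+e]*u e′ u′)))
  exponent-unique (suc e) zero     u u′ eq p∤u p∤u′ =
    ⊥-elim (p∤u′ (subst (p ∣_) (trans eq (*-identityˡ u′)) (p∣p^[1+e]*u e u)))
  exponent-unique (suc e) (suc e′) u u′ eq p∤u p∤u′ = cong suc (exponent-unique e e′ u u′
    (*-cancelˡ-≡ _ _ p (trans (sym (*-assoc p (p ^ e) u)) (trans eq (*-assoc p (p ^ e′) u′)))) p∤u p∤u′)

  ν-unique : ∀ m e u .{{_ : NonZero m}} → m ≡ p ^ e * u → ¬ p ∣ u → ν m ≡ e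
  ν-unique m e u m≡ p∤u with decompose m
  ... | u′ , m≡′ , p∤u′ = exponent-unique _ _ u′ u (trans (sym m≡′) m≡) p∤u′ p∤u

  ν-1 : ν 1 ≡ 0
  ν-1 = ν-unique 1 0 1 refl p∤1

  ν-p : ν p ≡ 1
  ν-p = ν-unique p 1 1 (sym (trans (*-identityʳ _) (*-identityʳ p))) p∤1

  p∤* : ∀ a b → ¬ p ∣ a → ¬ p ∣ b → ¬ p ∣ a * b
  p∤* a b p∤a p∤b p∣ab with euclidsLemma a b p-prime p∣ab
  ... | inj₁ p∣a = p∤a p∣a
  ... | inj₂ p∣b = p∤b p∣b

  ν-* : ∀ a b .{{_ : NonZero a}} .{{_ : NonZero b}} → ν (a * b) ≡ ν a + ν b
  ν-* a b with decompose a | decompose b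
  ... | u , a≡ , p∤u | w , b≡ , p∤w = ν-unique (a * b) _ (u * w) {{m*n≢0 a b}} ab≡ (p∤* u w p∤u p∤w)
    where
    open ≡-Reasoning
    ab≡ : a * b ≡ p ^ (ν a + ν b) * (u * w)
    ab≡ = begin
      a * b                          ≡⟨ cong₂ _*_ a≡ b≡ ⟩
      (p ^ ν a * u) * (p ^ ν b * w)  ≡⟨ interchange (p ^ ν a) u (p ^ ν b) w ⟩
      (p ^ ν a * p ^ ν b) * (u * w)  ≡⟨ cong (_* (u * w)) (^-distribˡ-+-* p (ν a) (ν b)) ⟨
      p ^ (ν a + ν b) * (u * w)      ∎

  ≤ν⇒p^i∣ : ∀ m i .{{_ : NonZero m}} → i ≤ ν m → p ^ i ∣ m
  ≤ν⇒p^i∣ m i i≤ν with decompose m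
  ... | u , m≡ , _ = subst (p ^ i ∣_) (sym m≡) (∣m⇒∣m*n u (subst (p ^ i ∣_) p^ν≡ (m∣m*n (p ^ (ν m ∸ i)))))
    where
    p^ν≡ : p ^ i * p ^ (ν m ∸ i) ≡ p ^ ν m
    p^ν≡ = trans (sym (^-distribˡ-+-* p i (ν m ∸ i))) (cong (p ^_) (m+[n∸m]≡n i≤ν))

  p^i∣⇒≤ν : ∀ m i .{{_ : NonZero m}} → p ^ i ∣ m → i ≤ ν m
  p^i∣⇒≤ν m i p^i∣m with decompose m | i ≤? ν m
  ... | _ | yes i≤ν = i≤ν
  ... | u , m≡ , p∤u | no i≰ν = ⊥-elim (p∤u (∣-trans (p∣p^[1+e]*u k 1) p^[1+k]∣u))
    where
    k = i ∸ suc (ν m)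
    i≡ : i ≡ ν m + suc k
    i≡ = sym (trans (+-suc (ν m) k) (m+[n∸m]≡n (≰⇒> i≰ν)))
    p^[1+k]∣u : p ^ suc k * 1 ∣ u
    p^[1+k]∣u = subst (_∣ u) (sym (*-identityʳ _)) (*-cancelˡ-∣ (p ^ ν m) {{p^i≢0 (ν m)}}
      (subst₂ _∣_ (trans (cong (p ^_) i≡) (^-distribˡ-+-* p (ν m) (suc k))) m≡ p^i∣m))

  i<p^i : ∀ i → i < p ^ i
  i<p^i zero    = s≤s z≤n
  i<p^i (suc i) = ≤-<-trans (i<p^i i) (subst (p ^ i <_) (*-comm (p ^ i) p) (m<m*n (p ^ i) p {{p^i≢0 i}} 1<p))

  ν<m : ∀ m .{{_ : NonZero m}} → ν m < m
  ν<m m = <-≤-trans (i<p^i (ν m)) (∣⇒≤ (≤ν⇒p^i∣ m (ν m) ≤-refl))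

module _ where
  open Valuation using (ν)

  primeProduct-∣ : ∀ qs → All Prime qs → ∀ N .{{_ : NonZero N}} →
                   (∀ p (p-prime : Prime p) → ν p p-prime (product qs) ≤ ν p p-prime N) → product qs ∣ N
  primeProduct-∣ []       []                 N _      = 1∣ N
  primeProduct-∣ (q ∷ qs) (q-prime ∷ qs-prime) N ν≤ν =
    subst (q * product qs ∣_) (sym N≡qN′) (*-monoʳ-∣ q (primeProduct-∣ qs qs-prime N′ ν≤ν′))
    where
    instance
      q≢0 : NonZero q
      q≢0 = prime⇒nonZero q-prime
      Q≢0 : NonZero (product qs)
      Q≢0 = productOfPrimes≢0 qs-prime
    q∣N : q ∣ N
    q∣N = subst (_∣ N) (*-identityʳ q) (Valuation.≤ν⇒p^i∣ q q-prime N 1 (begin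
      1                                                 ≡⟨ Valuation.ν-p q q-prime ⟨
      ν q q-prime q                                     ≤⟨ m≤m+n _ _ ⟩
      ν q q-prime q + ν q q-prime (product qs)          ≡⟨ Valuation.ν-* q q-prime q (product qs) ⟨
      ν q q-prime (q * product qs)                      ≤⟨ ν≤ν q q-prime ⟩
      ν q q-prime N                                     ∎))
      where open ≤-Reasoning
    N′ = quotient q∣N
    N≡qN′ : N ≡ q * N′
    N≡qN′ = m∣n⇒n≡m*quotient q∣N
    instance
      N′≢0 : NonZero N′
      N′≢0 = ≢-nonZero λ N′≡0 → ≢-nonZero⁻¹ N (trans N≡qN′ (trans (cong (q *_) N′≡0) (*-zeroʳ q)))
    ν≤ν′ : ∀ p p-prime → ν p p-prime (product qs) ≤ ν p p-prime N′
    ν≤ν′ p p-prime = +-cancelˡ-≤ (ν p p-prime q) _ _ (subst₂ _≤_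
      (Valuation.ν-* p p-prime q (product qs))
      (trans (cong (ν p p-prime) N≡qN′) (Valuation.ν-* p p-prime q N′))
      (ν≤ν p p-prime))

  ∣-byValuations : ∀ D N .{{_ : NonZero D}} .{{_ : NonZero N}} →
                   (∀ p (p-prime : Prime p) → ν p p-prime D ≤ ν p p-prime N) → D ∣ N
  ∣-byValuations D N ν≤ν = subst (_∣ N) D≡ (primeProduct-∣ (factors F) (factorsPrime F) N
      (λ p p-prime → subst (λ X → ν p p-prime X ≤ ν p p-prime N) (sym D≡) (ν≤ν p p-prime)))
    where
    open PrimeFactorisation
    F = factorise D
    D≡ : product (factors F) ≡ D
    D≡ = sym (isFactorisation F)

-- Floor division, totalised by m ÷ 0 = 0 so that it can be applied to
-- arbitrary (e.g. list-supplied) divisors.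
_÷_ : ℕ → ℕ → ℕ
m ÷ zero  = 0
m ÷ suc d = m / suc d

infixl 7 _÷_

÷-≡-/ : ∀ m d .{{_ : NonZero d}} → m ÷ d ≡ m / d
÷-≡-/ m (suc d) = refl

0÷d≡0 : ∀ d → 0 ÷ d ≡ 0
0÷d≡0 zero    = refl
0÷d≡0 (suc d) = refl

𝟙[_∣_] : ℕ → ℕ → ℕ
𝟙[ d ∣ m ] with d ∣? m
... | yes _ = 1
... | no  _ = 0

𝟙-yes : ∀ {d m} → d ∣ m → 𝟙[ d ∣ m ] ≡ 1
𝟙-yes {d} {m} d∣m with d ∣? m
... | yes _   = refl
... | no  d∤m = ⊥-elim (d∤m d∣m)

𝟙-no : ∀ {d m} → ¬ d ∣ m → 𝟙[ d ∣ m ] ≡ 0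
𝟙-no {d} {m} d∤m with d ∣? m
... | yes d∣m = ⊥-elim (d∤m d∣m)
... | no  _   = refl

/-unique : ∀ r k d .{{_ : NonZero d}} → r < d → (r + k * d) / d ≡ k
/-unique r k d r<d = begin
  (r + k * d) / d        ≡⟨ +-distrib-/-∣ʳ r (n∣m*n k) ⟩
  r / d + k * d / d      ≡⟨ cong₂ _+_ (m<n⇒m/n≡0 r<d) (m*n/n≡m k d) ⟩
  k                      ∎
  where open ≡-Reasoning

÷-suc : ∀ m d → suc m ÷ d ≡ 𝟙[ d ∣ suc m ] + m ÷ d
÷-suc m zero = sym (cong (_+ 0) (𝟙-no {0} {suc m} λ 0∣ → 1+n≢0 (0∣⇒≡0 0∣)))
÷-suc m d@(suc _) with m≤n⇒m<n∨m≡n (m%n<n m d)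
... | inj₁ 1+r<d = begin
  suc m / d              ≡⟨ /-congˡ {o = d} (cong suc (m≡m%n+[m/n]*n m d)) ⟩
  (suc r + k * d) / d    ≡⟨ /-unique (suc r) k d 1+r<d ⟩
  k                      ≡⟨ cong (_+ k) (𝟙-no {d} {suc m} d∤) ⟨
  𝟙[ d ∣ suc m ] + k     ∎
  where
  open ≡-Reasoning
  r = m % d
  k = m / d
  1+m≡ : suc m ≡ k * d + suc r
  1+m≡ = trans (cong suc (m≡m%n+[m/n]*n m d)) (+-comm (suc r) (k * d))
  d∤ : ¬ d ∣ suc m
  d∤ d∣ = <⇒≱ 1+r<d (∣⇒≤ (∣m+n∣m⇒∣n (subst (d ∣_) 1+m≡ d∣) (n∣m*n k)))
... | inj₂ 1+r≡d = begin
  suc m / d              ≡⟨ /-congˡ {o = d} 1+m≡ ⟩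
  suc k * d / d          ≡⟨ m*n/n≡m (suc k) d ⟩
  1 + k                  ≡⟨ cong (_+ k) (𝟙-yes {d} {suc m} (divides (suc k) 1+m≡)) ⟨
  𝟙[ d ∣ suc m ] + k     ∎
  where
  open ≡-Reasoning
  k = m / d
  1+m≡ : suc m ≡ suc k * d
  1+m≡ = trans (cong suc (m≡m%n+[m/n]*n m d)) (cong (_+ k * d) 1+r≡d)

sumTo : ℕ → (ℕ → ℕ) → ℕ
sumTo zero    f = 0
sumTo (suc B) f = f (suc B) + sumTo B f

sumTo-cong : ∀ B {f g} → (∀ i → f i ≡ g i) → sumTo B f ≡ sumTo B g
sumTo-cong zero    f≡g = refl
sumTo-cong (suc B) f≡g = cong₂ _+_ (f≡g (suc B)) (sumTo-cong B f≡g)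

sumTo-+ : ∀ B f g → sumTo B (λ i → f i + g i) ≡ sumTo B f + sumTo B g
sumTo-+ zero    f g = refl
sumTo-+ (suc B) f g = trans (cong (f (suc B) + g (suc B) +_) (sumTo-+ B f g))
                            (+-interchange (f (suc B)) (g (suc B)) (sumTo B f) (sumTo B g))

sumTo-mono : ∀ B {f g} → (∀ i → 1 ≤ i → f i ≤ g i) → sumTo B f ≤ sumTo B g
sumTo-mono zero    f≤g = z≤n
sumTo-mono (suc B) f≤g = +-mono-≤ (f≤g (suc B) (s≤s z≤n)) (sumTo-mono B f≤g)

sumTo-zero : ∀ B {f} → (∀ i → f i ≡ 0) → sumTo B f ≡ 0
sumTo-zero zero    f≡0 = refl
sumTo-zero (suc B) f≡0 = cong₂ _+_ (f≡0 (suc B)) (sumTo-zero B f≡0)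

sumTo-count : ∀ B v {f} → v ≤ B → (∀ i → 1 ≤ i → i ≤ v → f i ≡ 1) → (∀ i → v < i → i ≤ B → f i ≡ 0) →
              sumTo B f ≡ v
sumTo-count zero    zero z≤n   isOne isZero = refl
sumTo-count (suc B) v    v≤1+B isOne isZero with m≤n⇒m<n∨m≡n v≤1+B
... | inj₁ v<1+B = cong₂ _+_ (isZero (suc B) v<1+B ≤-refl)
                             (sumTo-count B v (≤-pred v<1+B) isOne (λ i v<i i≤B → isZero i v<i (m≤n⇒m≤1+n i≤B)))
... | inj₂ refl  = cong₂ _+_ (isOne (suc B) (s≤s z≤n) ≤-refl)
                             (sumTo-count B B ≤-refl (λ i 1≤i i≤B → isOne i 1≤i (m≤n⇒m≤1+n i≤B))
                                                     (λ i B<i i≤B → ⊥-elim (<⇒≱ B<i i≤B)))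

factorials : List ℕ → ℕ
factorials xs = product (map _! xs)

floorSum : List ℕ → ℕ → ℕ
floorSum xs d = sum (map (_÷ d) xs)

factorials≢0 : ∀ xs → NonZero (factorials xs)
factorials≢0 []       = _
factorials≢0 (x ∷ xs) = m*n≢0 (x !) (factorials xs) {{x !≢0}} {{factorials≢0 xs}}

module Legendre (p : ℕ) (p-prime : Prime p) where
  open Valuation p p-prime

  countPowers : ∀ B m .{{_ : NonZero m}} → ν m ≤ B → sumTo B (λ i → 𝟙[ p ^ i ∣ m ]) ≡ ν m
  countPowers B m ν≤B = sumTo-count B (ν m) ν≤B
    (λ i _ i≤ν → 𝟙-yes (≤ν⇒p^i∣ m i i≤ν))
    (λ i ν<i _ → 𝟙-no (λ p^i∣m → <⇒≱ ν<i (p^i∣⇒≤ν m i p^i∣m)))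

  legendre : ∀ B m → m ≤ B → ν (m !) ≡ sumTo B (λ i → m ÷ p ^ i)
  legendre B zero    _     = trans ν-1 (sym (sumTo-zero B (λ i → 0÷d≡0 (p ^ i))))
  legendre B (suc m) 1+m≤B = begin
    ν (suc m * m !)                                                    ≡⟨ ν-* (suc m) (m !) {{_}} {{m !≢0}} ⟩
    ν (suc m) + ν (m !)                                                ≡⟨ cong₂ _+_ (sym counted) (legendre B m (<⇒≤ 1+m≤B)) ⟩
    sumTo B (λ i → 𝟙[ p ^ i ∣ suc m ]) + sumTo B (λ i → m ÷ p ^ i)      ≡⟨ sumTo-+ B _ _ ⟨
    sumTo B (λ i → 𝟙[ p ^ i ∣ suc m ] + m ÷ p ^ i)                      ≡⟨ sumTo-cong B (λ i → sym (÷-suc m (p ^ i))) ⟩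
    sumTo B (λ i → suc m ÷ p ^ i)                                      ∎
    where
    open ≡-Reasoning
    counted : sumTo B (λ i → 𝟙[ p ^ i ∣ suc m ]) ≡ ν (suc m)
    counted = countPowers B (suc m) (<⇒≤ (<-≤-trans (ν<m (suc m)) 1+m≤B))

  legendre-factorials : ∀ B xs → All (_≤ B) xs → ν (factorials xs) ≡ sumTo B (λ i → floorSum xs (p ^ i))
  legendre-factorials B []       []           = trans ν-1 (sym (sumTo-zero B (λ _ → refl)))
  legendre-factorials B (x ∷ xs) (x≤B ∷ xs≤B) = begin
    ν (x ! * factorials xs)                                   ≡⟨ ν-* (x !) (factorials xs) {{x !≢0}} {{factorials≢0 xs}} ⟩
    ν (x !) + ν (factorials xs)                               ≡⟨ cong₂ _+_ (legendre B x x≤B) (legendre-factorials B xs xs≤B) ⟩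
    sumTo B (λ i → x ÷ p ^ i) + sumTo B (λ i → floorSum xs (p ^ i)) ≡⟨ sumTo-+ B _ _ ⟨
    sumTo B (λ i → floorSum (x ∷ xs) (p ^ i))                  ∎
    where open ≡-Reasoning

landau : ∀ xs ys → (∀ d → 2 ≤ d → floorSum xs d ≤ floorSum ys d) → factorials xs ∣ factorials ys
landau xs ys floor≤ = ∣-byValuations (factorials xs) (factorials ys) {{factorials≢0 xs}} {{factorials≢0 ys}} ν≤ν
  where
  B = sum xs + sum ys
  bounded : ∀ zs → All (_≤ sum zs) zs
  bounded []       = []
  bounded (z ∷ zs) = m≤m+n z (sum zs) ∷ All.map (λ z′≤ → ≤-trans z′≤ (m≤n+m (sum zs) z)) (bounded zs)
  ν≤ν : ∀ p p-prime → Valuation.ν p p-prime (factorials xs) ≤ Valuation.ν p p-prime (factorials ys)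
  ν≤ν p p-prime = subst₂ _≤_
    (sym (legendre-factorials B xs (All.map (λ x≤ → ≤-trans x≤ (m≤m+n _ _)) (bounded xs))))
    (sym (legendre-factorials B ys (All.map (λ y≤ → ≤-trans y≤ (m≤n+m _ _)) (bounded ys))))
    (sumTo-mono B (λ i 1≤i → floor≤ (p ^ i) (2≤p^i i 1≤i)))
    where
    open Legendre p p-prime
    2≤p^i : ∀ i → 1 ≤ i → 2 ≤ p ^ i
    2≤p^i (suc i) _ = ≤-trans (Valuation.1<p p p-prime) (m≤m*n p (p ^ i) {{Valuation.p^i≢0 p p-prime i}})

-- Floor sums with coefficients dividing 60.  For d ≥ 1 put t = ⌊60n/d⌋; then
-- ⌊kn/d⌋ = ⌊t/(60/k)⌋ for every k ∣ 60, so all the floor sums needed below are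
-- sums Σ_{c ∈ cs} ⌊t/c⌋ over divisors c of 60, which are 60-periodic up to a
-- linear term and can therefore be compared on a single period.
divSum : List ℕ → ℕ → ℕ
divSum cs t = sum (map (t ÷_) cs)

periods : List ℕ → List ℕ
periods = map (60 ÷_)

÷-rescale : ∀ k m n d → m * k ≡ 60 → (k * n) ÷ d ≡ (60 * n) ÷ d ÷ m
÷-rescale k m       n zero    mk≡60 = sym (0÷d≡0 m)
÷-rescale k zero    n (suc d) ()
÷-rescale k (suc m) n (suc d) mk≡60 = begin
  k * n / D              ≡⟨ m*n/m*o≡n/o M (k * n) D ⟨
  M * (k * n) / (M * D)  ≡⟨ /-congˡ (trans (sym (*-assoc M k n)) (cong (_* n) mk≡60)) ⟩
  60 * n / (M * D)       ≡⟨ /-congʳ {m = 60 * n} (*-comm M D) ⟩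
  60 * n / (D * M)       ≡⟨ m/n/o≡m/[n*o] (60 * n) D M ⟨
  60 * n / D / M         ∎
  where
  open ≡-Reasoning
  M = suc m
  D = suc d

cofactor-60 : ∀ k → k ∣ 60 → 60 ÷ k * k ≡ 60
cofactor-60 zero    0∣60 = ⊥-elim (1+n≢0 (0∣⇒≡0 0∣60))
cofactor-60 (suc k) k∣60 = m/n*n≡m k∣60

scaledFloorSum : ∀ n d ks → All (_∣ 60) ks → floorSum (map (_* n) ks) d ≡ divSum (periods ks) ((60 * n) ÷ d)
scaledFloorSum n d []       []             = refl
scaledFloorSum n d (k ∷ ks) (k∣60 ∷ ks∣60) =
  cong₂ _+_ (÷-rescale k (60 ÷ k) n d (cofactor-60 k k∣60)) (scaledFloorSum n d ks ks∣60)

indicators : ℕ → ℕ → List ℕ → ℕ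
indicators n d us = sum (map (λ u → 𝟙[ d ∣ suc (u * n) ]) us)

shiftedFloorSum : ∀ n d us → floorSum (map (λ u → suc (u * n)) us) d ≡ indicators n d us + floorSum (map (_* n) us) d
shiftedFloorSum n d []       = refl
shiftedFloorSum n d (u ∷ us) = trans (cong₂ _+_ (÷-suc (u * n) d) (shiftedFloorSum n d us))
  (+-interchange 𝟙[ d ∣ suc (u * n) ] (u * n ÷ d) (indicators n d us) (floorSum (map (_* n) us) d))

floorSum-++ : ∀ xs ys d → floorSum (xs ++ ys) d ≡ floorSum xs d + floorSum ys d
floorSum-++ xs ys d = trans (cong sum (map-++ (_÷ d) xs ys)) (sum-++ (map (_÷ d) xs) (map (_÷ d) ys))

reducedFloorSum : ∀ n d us ks → All (_∣ 60) (us ++ ks) →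
  floorSum (map (λ u → suc (u * n)) us ++ map (_* n) ks) d ≡ indicators n d us + divSum (periods (us ++ ks)) ((60 * n) ÷ d)
reducedFloorSum n d us ks us++ks∣60 = begin
  floorSum (shifted ++ scaled ks) d                      ≡⟨ floorSum-++ shifted (scaled ks) d ⟩
  floorSum shifted d + floorSum (scaled ks) d            ≡⟨ cong (_+ floorSum (scaled ks) d) (shiftedFloorSum n d us) ⟩
  I + floorSum (scaled us) d + floorSum (scaled ks) d    ≡⟨ +-assoc I _ _ ⟩
  I + (floorSum (scaled us) d + floorSum (scaled ks) d)  ≡⟨ cong (I +_) (floorSum-++ (scaled us) (scaled ks) d) ⟨
  I + floorSum (scaled us ++ scaled ks) d                ≡⟨ cong (λ xs → I + floorSum xs d) (map-++ (_* n) us ks) ⟨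
  I + floorSum (scaled (us ++ ks)) d                     ≡⟨ cong (I +_) (scaledFloorSum n d (us ++ ks) us++ks∣60) ⟩
  I + divSum (periods (us ++ ks)) ((60 * n) ÷ d)         ∎
  where
  open ≡-Reasoning
  shifted = map (λ u → suc (u * n)) us
  scaled : List ℕ → List ℕ
  scaled = map (_* n)
  I = indicators n d us

divSum-periodic : ∀ cs r q → All (_∣ 60) cs → divSum cs (r + q * 60) ≡ divSum cs r + q * divSum cs 60
divSum-periodic []       r q []             = sym (*-zeroʳ q)
divSum-periodic (c ∷ cs) r q (c∣60 ∷ cs∣60) = trans (cong₂ _+_ (one c c∣60) (divSum-periodic cs r q cs∣60))
  (trans (+-interchange (r ÷ c) (q * (60 ÷ c)) (divSum cs r) (q * divSum cs 60))
         (cong (r ÷ c + divSum cs r +_) (sym (*-distribˡ-+ q (60 ÷ c) (divSum cs 60)))))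
  where
  one : ∀ c → c ∣ 60 → (r + q * 60) ÷ c ≡ r ÷ c + q * (60 ÷ c)
  one zero    0∣60 = ⊥-elim (1+n≢0 (0∣⇒≡0 0∣60))
  one (suc c) c∣60 = trans (+-distrib-/-∣ʳ r (∣n⇒∣m*n q c∣60)) (cong (r / suc c +_) (*-/-assoc q c∣60))

record Dominates (L R : List ℕ) : Set where
  field
    periodsL  : All (_∣ 60) L
    periodsR  : All (_∣ 60) R
    balanced  : divSum L 60 ≡ divSum R 60
    onePeriod : ∀ {r} → r < 60 → divSum L r ≤ divSum R r

dominates? : ∀ L R → Dec (Dominates L R)
dominates? L R = map′ toDominates fromDominates
  (All.all? (_∣? 60) L ×-dec All.all? (_∣? 60) R ×-dec divSum L 60 ≟ divSum R 60 ×-dec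
   allUpTo? (λ r → divSum L r ≤? divSum R r) 60)
  where
  Conditions = All (_∣ 60) L × All (_∣ 60) R × divSum L 60 ≡ divSum R 60 × (∀ {r} → r < 60 → divSum L r ≤ divSum R r)
  toDominates : Conditions → Dominates L R
  toDominates (pL , pR , bal , one) = record { periodsL = pL ; periodsR = pR ; balanced = bal ; onePeriod = one }
  fromDominates : Dominates L R → Conditions
  fromDominates L≤R = periodsL , periodsR , balanced , onePeriod
    where open Dominates L≤R

module _ {L R : List ℕ} (L≤R : Dominates L R) where
  open Dominates L≤R

  addPeriods : ∀ e r q → e + divSum L r ≤ divSum R r → e + divSum L (r + q * 60) ≤ divSum R (r + q * 60)
  addPeriods e r q ≤atr = begin
    e + divSum L (r + q * 60)            ≡⟨ cong (e +_) (divSum-periodic L r q periodsL) ⟩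
    e + (divSum L r + q * divSum L 60)   ≡⟨ +-assoc e _ _ ⟨
    e + divSum L r + q * divSum L 60     ≤⟨ +-mono-≤ ≤atr (≤-reflexive (cong (q *_) balanced)) ⟩
    divSum R r + q * divSum R 60         ≡⟨ divSum-periodic R r q periodsR ⟨
    divSum R (r + q * 60)                ∎
    where open ≤-Reasoning

  dominates : ∀ t → divSum L t ≤ divSum R t
  dominates t = subst (λ x → divSum L x ≤ divSum R x) (sym (m≡m%n+[m/n]*n t 60))
                      (addPeriods 0 (t % 60) (t / 60) (onePeriod (m%n<n t 60)))

-- If d ∣ cn + 1, say cn + 1 = jd, and mc = 60, then 60n = mjd − m, hence
-- ⌊60n/d⌋ = mj − o with o = ⌈m/d⌉ (given through the bounds on o * d).
floorAtDivisor : ∀ c m n j d o .{{_ : NonZero d}} → m * c ≡ 60 → suc (c * n) ≡ j * d →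
                 m ≤ o * d → o * d < m + d → o ≤ m * j → (60 * n) ÷ d ≡ m * j ∸ o
floorAtDivisor c m n j d o mc≡60 1+cn≡jd m≤od od<m+d o≤mj =
  trans (÷-≡-/ (60 * n) d) (trans (/-congˡ {o = d} 60n≡) (/-unique r q d r<d))
  where
  r = o * d ∸ m
  q = m * j ∸ o
  r+m≡od : r + m ≡ o * d
  r+m≡od = m∸n+n≡m m≤od
  r<d : r < d
  r<d = +-cancelʳ-< m r d (subst₂ _<_ (sym r+m≡od) (+-comm m d) od<m+d)
  60n≡ : 60 * n ≡ r + q * d
  60n≡ = +-cancelʳ-≡ m _ _ (begin
    60 * n + m           ≡⟨ cong (λ x → x * n + m) {m * c} {60} mc≡60 ⟨
    m * c * n + m        ≡⟨ expand m c n ⟩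
    m * suc (c * n)      ≡⟨ cong (m *_) 1+cn≡jd ⟩
    m * (j * d)          ≡⟨ *-assoc m j d ⟨
    m * j * d            ≡⟨ cong (_* d) (m∸n+n≡m o≤mj) ⟨
    (q + o) * d          ≡⟨ *-distribʳ-+ d q o ⟩
    q * d + o * d        ≡⟨ cong (q * d +_) r+m≡od ⟨
    q * d + (r + m)      ≡⟨ regroup (q * d) r m ⟩
    r + q * d + m        ∎)
    where
    open ≡-Reasoning
    expand : ∀ m c n → m * c * n + m ≡ m * suc (c * n)
    expand = solve-∀
    regroup : ∀ x r m → x + (r + m) ≡ r + x + m
    regroup = solve-∀

ceiling-bounds : ∀ m d .{{_ : NonZero d}} → 1 ≤ m → m ≤ suc ((m ∸ 1) / d) * d × suc ((m ∸ 1) / d) * d < m + d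
ceiling-bounds (suc a) d _ = lower , upper
  where
  lower : suc a ≤ d + a / d * d
  lower = begin
    suc a                    ≡⟨ cong suc (m≡m%n+[m/n]*n a d) ⟩
    suc (a % d) + a / d * d  ≤⟨ +-monoˡ-≤ (a / d * d) (m%n<n a d) ⟩
    d + a / d * d            ∎
    where open ≤-Reasoning
  upper : d + a / d * d < suc a + d
  upper = subst (d + a / d * d <_) (+-comm d (suc a)) (+-monoʳ-< d (s≤s (m/n*n≤m a d)))

∤1+ : ∀ {e a} → 2 ≤ e → e ∣ a → ¬ e ∣ suc a
∤1+ {e} {a} 2≤e e∣a e∣1+a = <⇒≢ 2≤e (sym (∣1⇒≡1 (∣m+n∣m⇒∣n (subst (e ∣_) (+-comm 1 a) e∣1+a) e∣a)))

coprime-1+cn : ∀ {e} c n → e ∣ suc (c * n) → Coprime e c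
coprime-1+cn {e} c n e∣1+cn {i} (i∣e , i∣c) =
  ∣1⇒≡1 (∣m+n∣m⇒∣n (subst (i ∣_) (+-comm 1 (c * n)) (∣-trans i∣e e∣1+cn)) (∣m⇒∣m*n n i∣c))

coprime-% : ∀ j c .{{_ : NonZero c}} → Coprime j c → Coprime (j % c) c
coprime-% j c j⊥c {i} (i∣s , i∣c) =
  j⊥c (subst (i ∣_) (sym (m≡m%n+[m/n]*n j c)) (∣m∣n⇒∣m+n i∣s (∣n⇒∣m*n (j / c) i∣c)) , i∣c)

-- CeilingBound: ⌈m/e⌉ ≤ omax for the e < m (e ≥ 2) that may divide a number cn + 1.
StrictOnResidues : List ℕ → List ℕ → ℕ → ℕ → ℕ → Set
StrictOnResidues L R c m omax =
  ∀ {s} → s < c → Coprime s c → ∀ {o} → o < omax → suc (divSum L (m * s ∸ suc o)) ≤ divSum R (m * s ∸ suc o)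

strictOnResidues? : ∀ L R c m omax → Dec (StrictOnResidues L R c m omax)
strictOnResidues? L R c m omax = allUpTo? (λ s → coprime? s c →-dec
  allUpTo? (λ o → suc (divSum L (m * s ∸ suc o)) ≤? divSum R (m * s ∸ suc o)) omax) c

CeilingBound : ℕ → ℕ → ℕ → Set
CeilingBound c m omax = ∀ {e} → e < m → 2 ≤ e → Coprime e c → m ≤ omax * e

ceilingBound? : ∀ c m omax → Dec (CeilingBound c m omax)
ceilingBound? c m omax = allUpTo? (λ e → 2 ≤? e →-dec (coprime? e c →-dec m ≤? omax * e)) m

strictAt : ∀ {L R} c m omax → Dominates L R → m * c ≡ 60 → 2 ≤ c → StrictOnResidues L R c m omax →
  ∀ j o → Coprime j c → o < omax → suc o ≤ m → suc (divSum L (m * j ∸ suc o)) ≤ divSum R (m * j ∸ suc o)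
strictAt {L} {R} c@(suc _) m omax L≤R mc≡60 2≤c onResidues j o j⊥c o<omax 1+o≤m =
  subst (λ t → suc (divSum L t) ≤ divSum R t) (sym t≡)
        (addPeriods L≤R 1 (m * s ∸ suc o) q (onResidues (m%n<n j c) s⊥c o<omax))
  where
  s = j % c
  q = j / c
  s⊥c : Coprime s c
  s⊥c = coprime-% j c j⊥c
  instance
    s≢0 : NonZero s
    s≢0 = ≢-nonZero λ s≡0 → <⇒≢ 2≤c (sym (s⊥c (subst (c ∣_) (sym s≡0) (c ∣0) , ∣-refl)))
  mj≡ : m * j ≡ m * s + q * 60
  mj≡ = begin
    m * j                 ≡⟨ cong (m *_) (m≡m%n+[m/n]*n j c) ⟩
    m * (s + q * c)       ≡⟨ distribute m s q c ⟩
    m * s + q * (m * c)   ≡⟨ cong (λ x → m * s + q * x) mc≡60 ⟩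
    m * s + q * 60        ∎
    where
    open ≡-Reasoning
    distribute : ∀ m s q c → m * (s + q * c) ≡ m * s + q * (m * c)
    distribute = solve-∀
  t≡ : m * j ∸ suc o ≡ (m * s ∸ suc o) + q * 60
  t≡ = trans (cong (_∸ suc o) mj≡) (+-∸-comm (q * 60) (≤-trans 1+o≤m (m≤m*n m s)))

-- The floor-sum inequality 𝟙[d ∣ cn + 1] + divSum L t ≤ divSum R t, t = ⌊60n/d⌋,
-- for all n and d ≥ 2.  Besides Dominates L R it needs: the strict inequality at
-- t = ms − o for residues s prime to c and 1 ≤ o ≤ omax, and omax * e ≥ m for the
-- small possible divisors e < m of cn + 1 (these are coprime to c), which bounds
-- the correction o = ⌈m/d⌉ in ⌊60n/d⌋ = mj − o.
indicatorBound : ∀ L R c m omax → Dominates L R → m * c ≡ 60 → 2 ≤ c → 1 ≤ omax →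
  CeilingBound c m omax → StrictOnResidues L R c m omax →
  ∀ n d → 2 ≤ d → 𝟙[ d ∣ suc (c * n) ] + divSum L ((60 * n) ÷ d) ≤ divSum R ((60 * n) ÷ d)
indicatorBound L R c zero omax L≤R () 2≤c 1≤omax ceilingBound onResidues n d 2≤d
indicatorBound L R c m@(suc _) omax L≤R mc≡60 2≤c 1≤omax ceilingBound onResidues n d@(suc _) 2≤d
  with d ∣? suc (c * n)
... | no _ = dominates L≤R ((60 * n) ÷ d)
... | yes d∣@(divides j 1+cn≡jd) =
  subst (λ t → suc (divSum L t) ≤ divSum R t) (sym t≡)
        (strictAt c m omax L≤R mc≡60 2≤c onResidues j o′ j⊥c o′<omax 1+o′≤m)
  where
  o′ = (m ∸ 1) / d
  bounds : m ≤ suc o′ * d × suc o′ * d < m + d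
  bounds = ceiling-bounds m d (s≤s z≤n)
  j⊥c : Coprime j c
  j⊥c = coprime-1+cn c n (divides d (trans 1+cn≡jd (*-comm j d)))
  instance
    j≢0 : NonZero j
    j≢0 = ≢-nonZero λ j≡0 → 1+n≢0 (trans 1+cn≡jd (cong (_* d) j≡0))
    omax≢0 : NonZero omax
    omax≢0 = >-nonZero 1≤omax
  m≤omax*d : m ≤ omax * d
  m≤omax*d with m ≤? d
  ... | yes m≤d = ≤-trans m≤d (m≤n*m d omax)
  ... | no  m≰d = ceilingBound (≰⇒> m≰d) 2≤d (coprime-1+cn c n d∣)
  o′<omax : o′ < omax
  o′<omax = ≤-pred (*-cancelʳ-< d (suc o′) (suc omax) (<-≤-trans (proj₂ bounds)
    (≤-trans (+-monoˡ-≤ d m≤omax*d) (≤-reflexive (+-comm (omax * d) d)))))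
  1+o′≤m : suc o′ ≤ m
  1+o′≤m = s≤s (m/n≤m (m ∸ 1) d)
  t≡ : (60 * n) ÷ d ≡ m * j ∸ suc o′
  t≡ = floorAtDivisor c m n j d (suc o′) mc≡60 1+cn≡jd (proj₁ bounds) (proj₂ bounds) (≤-trans 1+o′≤m (m≤m*n m j))

scaledLandau : ∀ us ks ls → All (_∣ 60) (us ++ ks) → All (_∣ 60) ls →
  (∀ n d → 2 ≤ d → indicators n d us + divSum (periods (us ++ ks)) ((60 * n) ÷ d) ≤ divSum (periods ls) ((60 * n) ÷ d)) →
  ∀ n → factorials (map (λ u → suc (u * n)) us ++ map (_* n) ks) ∣ factorials (map (_* n) ls)
scaledLandau us ks ls us++ks∣60 ls∣60 bound n = landau (map (λ u → suc (u * n)) us ++ map (_* n) ks) (map (_* n) ls) λ d 2≤d →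
  subst₂ _≤_ (sym (reducedFloorSum n d us ks us++ks∣60)) (sym (reducedFloorSum n d [] ls ls∣60)) (bound n d 2≤d)

singleShiftLandau : ∀ c m omax ks ls → m * c ≡ 60 → 2 ≤ c → 1 ≤ omax →
  {True (All.all? (_∣? 60) (c ∷ ks))} → {True (All.all? (_∣? 60) ls)} →
  {True (dominates? (periods (c ∷ ks)) (periods ls))} → {True (ceilingBound? c m omax)} →
  {True (strictOnResidues? (periods (c ∷ ks)) (periods ls) c m omax)} →
  ∀ n → factorials (suc (c * n) ∷ map (_* n) ks) ∣ factorials (map (_* n) ls)
singleShiftLandau c m omax ks ls mc≡60 2≤c 1≤omax {c∷ks∣60} {ls∣60} {L≤R} {ceiling} {residues} =
  scaledLandau (c ∷ []) ks ls (toWitness c∷ks∣60) (toWitness ls∣60) λ n d 2≤d →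
    subst (λ x → x + divSum (periods (c ∷ ks)) ((60 * n) ÷ d) ≤ divSum (periods ls) ((60 * n) ÷ d))
          (sym (+-identityʳ 𝟙[ d ∣ suc (c * n) ]))
      (indicatorBound (periods (c ∷ ks)) (periods ls) c m omax (toWitness L≤R) mc≡60 2≤c 1≤omax
                      (toWitness ceiling) (toWitness residues) n d 2≤d)

catalan₄-landau : ∀ n → factorials (suc (12 * n) ∷ 3 * n ∷ []) ∣ factorials (15 * n ∷ [])
catalan₄-landau = singleShiftLandau 12 5 1 (3 ∷ []) (15 ∷ []) refl (s≤s (s≤s z≤n)) (s≤s z≤n)

catalan₂-landau : ∀ n → factorials (suc (10 * n) ∷ 5 * n ∷ []) ∣ factorials (15 * n ∷ [])
catalan₂-landau = singleShiftLandau 10 6 2 (5 ∷ []) (15 ∷ []) refl (s≤s (s≤s z≤n)) (s≤s z≤n)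

part₂-landau : ∀ n → factorials (suc (10 * n) ∷ 4 * n ∷ 3 * n ∷ []) ∣ factorials (15 * n ∷ 2 * n ∷ [])
part₂-landau = singleShiftLandau 10 6 2 (4 ∷ 3 ∷ []) (15 ∷ 2 ∷ []) refl (s≤s (s≤s z≤n)) (s≤s z≤n)

-- For d ≥ 2 at most one of 12n + 1 and 6n + 1 is divisible by d, as 2(6n + 1) = (12n + 1) + 1.
atMostOneIndicator : ∀ n d → 2 ≤ d → 𝟙[ d ∣ suc (12 * n) ] ≡ 0 ⊎ 𝟙[ d ∣ suc (6 * n) ] ≡ 0
atMostOneIndicator n d 2≤d with d ∣? suc (6 * n)
... | no  _       = inj₂ refl
... | yes d∣1+6n = inj₁ (𝟙-no λ d∣1+12n → ∤1+ 2≤d d∣1+12n (subst (d ∣_) (double n) (∣n⇒∣m*n 2 d∣1+6n)))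
  where
  double : ∀ n → 2 * suc (6 * n) ≡ suc (suc (12 * n))
  double = solve-∀

-- The Landau step of the first divisibility has two shifted numerators, 12n + 1
-- and 6n + 1; the indicator inequality for whichever of them d may divide suffices.
part₁-landau : ∀ n → factorials (suc (12 * n) ∷ suc (6 * n) ∷ 2 * n ∷ 5 * n ∷ []) ∣ factorials (15 * n ∷ 4 * n ∷ 6 * n ∷ [])
part₁-landau = scaledLandau (12 ∷ 6 ∷ []) (2 ∷ 5 ∷ []) (15 ∷ 4 ∷ 6 ∷ [])
  (from-yes (All.all? (_∣? 60) (12 ∷ 6 ∷ 2 ∷ 5 ∷ []))) (from-yes (All.all? (_∣? 60) (15 ∷ 4 ∷ 6 ∷ []))) bound
  where
  L = periods (12 ∷ 6 ∷ 2 ∷ 5 ∷ [])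
  R = periods (15 ∷ 4 ∷ 6 ∷ [])
  L≤R : Dominates L R
  L≤R = from-yes (dominates? L R)
  bound : ∀ n d → 2 ≤ d → indicators n d (12 ∷ 6 ∷ []) + divSum L ((60 * n) ÷ d) ≤ divSum R ((60 * n) ÷ d)
  bound n d 2≤d with atMostOneIndicator n d 2≤d
  ... | inj₁ 𝟙₁₂≡0 = subst (λ i → i + divSum L t ≤ divSum R t) (sym total≡𝟙₆)
    (indicatorBound L R 6 10 2 L≤R refl (s≤s (s≤s z≤n)) (s≤s z≤n)
      (from-yes (ceilingBound? 6 10 2)) (from-yes (strictOnResidues? L R 6 10 2)) n d 2≤d)
    where
    t = (60 * n) ÷ d
    𝟙₆ = 𝟙[ d ∣ suc (6 * n) ]
    total≡𝟙₆ : indicators n d (12 ∷ 6 ∷ []) ≡ 𝟙₆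
    total≡𝟙₆ = trans (cong (_+ (𝟙₆ + 0)) 𝟙₁₂≡0) (+-identityʳ 𝟙₆)
  ... | inj₂ 𝟙₆≡0 = subst (λ i → i + divSum L t ≤ divSum R t) (sym total≡𝟙₁₂)
    (indicatorBound L R 12 5 1 L≤R refl (s≤s (s≤s z≤n)) (s≤s z≤n)
      (from-yes (ceilingBound? 12 5 1)) (from-yes (strictOnResidues? L R 12 5 1)) n d 2≤d)
    where
    t = (60 * n) ÷ d
    𝟙₁₂ = 𝟙[ d ∣ suc (12 * n) ]
    total≡𝟙₁₂ : indicators n d (12 ∷ 6 ∷ []) ≡ 𝟙₁₂
    total≡𝟙₁₂ = trans (cong (λ i → 𝟙₁₂ + (i + 0)) 𝟙₆≡0) (+-identityʳ 𝟙₁₂)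

rising : ℕ → ℕ → ℕ
rising a zero    = 1
rising a (suc r) = (a + suc r) * rising a r

rising-factorial : ∀ a r → (a + r) ! ≡ rising a r * a !
rising-factorial a zero    = trans (cong _! (+-identityʳ a)) (sym (*-identityˡ (a !)))
rising-factorial a (suc r) = begin
  (a + suc r) !                     ≡⟨ cong _! (+-suc a r) ⟩
  suc (a + r) * (a + r) !           ≡⟨ cong₂ _*_ (sym (+-suc a r)) (rising-factorial a r) ⟩
  (a + suc r) * (rising a r * a !)  ≡⟨ *-assoc (a + suc r) _ _ ⟨
  rising a (suc r) * a !            ∎
  where open ≡-Reasoning

rising-coprime : ∀ q a r → Prime q → q ∣ a → r < q → ¬ q ∣ rising a r
rising-coprime q a zero    q-prime q∣a r<q = Valuation.p∤1 q q-prime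
rising-coprime q a (suc r) q-prime q∣a r<q q∣rising with euclidsLemma (a + suc r) (rising a r) q-prime q∣rising
... | inj₁ q∣a+r = <⇒≱ r<q (∣⇒≤ (∣m+n∣m⇒∣n q∣a+r q∣a))
... | inj₂ q∣rest = rising-coprime q a r q-prime q∣a (<-trans (n<1+n r) r<q) q∣rest

factorial-qpart : ∀ q k → Prime q → Σ[ U ∈ ℕ ] ((q * k) ! ≡ q ^ k * k ! * U) × ¬ q ∣ U
factorial-qpart q zero    q-prime = 1 , cong _! (*-zeroʳ q) , Valuation.p∤1 q q-prime
factorial-qpart q@(suc q′) (suc k) q-prime with factorial-qpart q k q-prime
... | U , qk!≡ , q∤U = U * R , q[1+k]!≡ , Valuation.p∤* q q-prime U R q∤U q∤R
  where
  R = rising (q * k) q′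
  q∤R : ¬ q ∣ R
  q∤R = rising-coprime q (q * k) q′ q-prime (m∣m*n k) ≤-refl
  q[1+k]≡ : q * suc k ≡ q * k + q
  q[1+k]≡ = trans (*-suc q k) (+-comm q (q * k))
  q[1+k]!≡ : (q * suc k) ! ≡ q ^ suc k * suc k ! * (U * R)
  q[1+k]!≡ = begin
    (q * suc k) !                              ≡⟨ cong _! q[1+k]≡ ⟩
    (q * k + q) !                              ≡⟨ rising-factorial (q * k) q ⟩
    (q * k + q) * R * (q * k) !                ≡⟨ cong₂ (λ a b → a * R * b) (sym q[1+k]≡) qk!≡ ⟩
    q * suc k * R * (q ^ k * k ! * U)          ≡⟨ regroup q (suc k) R (q ^ k) (k !) U ⟩
    q * q ^ k * (suc k * k !) * (U * R)        ∎
    where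
    open ≡-Reasoning
    regroup : ∀ q k R Q K U → q * k * R * (Q * K * U) ≡ q * Q * (k * K) * (U * R)
    regroup = solve-∀

binomial-factorial : ∀ a b → ((a + b) C a) * (a ! * b !) ≡ (a + b) !
binomial-factorial a b = begin
  ((a + b) C a) * (a ! * b !)                           ≡⟨ cong (_* (a ! * b !)) (nCk≡n!/k![n-k]! a≤a+b) ⟩
  ((a + b) ! / (a ! * ((a + b) ∸ a) !)) * (a ! * b !)   ≡⟨ cong (_* (a ! * b !)) (/-congʳ (cong (λ x → a ! * x !) [a+b]∸a≡b)) ⟩
  ((a + b) ! / (a ! * b !)) * (a ! * b !)               ≡⟨ m/n*n≡m a!b!∣[a+b]! ⟩
  (a + b) !                                             ∎
  where
  open ≡-Reasoning
  a≤a+b : a ≤ a + b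
  a≤a+b = m≤m+n a b
  [a+b]∸a≡b : (a + b) ∸ a ≡ b
  [a+b]∸a≡b = m+n∸m≡n a b
  a!b!∣[a+b]! : a ! * b ! ∣ (a + b) !
  a!b!∣[a+b]! = subst (λ x → a ! * x ! ∣ (a + b) !) [a+b]∸a≡b (k![n∸k]!∣n! a≤a+b)
  instance
    a!b!≢0 : NonZero (a ! * b !)
    a!b!≢0 = a !* b !≢0
    a![a+b-a]!≢0 : NonZero (a ! * ((a + b) ∸ a) !)
    a![a+b-a]!≢0 = a !* ((a + b) ∸ a) !≢0

binomial≢0 : ∀ a b → NonZero ((a + b) C a)
binomial≢0 a b = ≢-nonZero λ C≡0 → ≢-nonZero⁻¹ ((a + b) !) {{(a + b) !≢0}}
  (trans (sym (binomial-factorial a b)) (cong (_* (a ! * b !)) C≡0))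

binomial-qpart : ∀ q a b → Prime q → Σ[ U ∈ ℕ ] Σ[ V ∈ ℕ ] (((q * a + q * b) C (q * a)) * U ≡ ((a + b) C a) * V) × ¬ q ∣ U
binomial-qpart q a b q-prime with factorial-qpart q a q-prime | factorial-qpart q b q-prime | factorial-qpart q (a + b) q-prime
... | Ua , qa!≡ , q∤Ua | Ub , qb!≡ , q∤Ub | Uab , qab!≡ , _ =
  Ua * Ub , Uab , *-cancelʳ-≡ _ _ K {{K≢0}} scaled , Valuation.p∤* q q-prime Ua Ub q∤Ua q∤Ub
  where
  open ≡-Reasoning
  X = (q * a + q * b) C (q * a)
  Y = (a + b) C a
  K = q ^ a * q ^ b * (a ! * b !)
  instance
    q≢0 : NonZero q
    q≢0 = prime⇒nonZero q-prime
  K≢0 : NonZero K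
  K≢0 = m*n≢0 (q ^ a * q ^ b) (a ! * b !) {{m*n≢0 (q ^ a) (q ^ b) {{m^n≢0 q a}} {{m^n≢0 q b}}}} {{a !* b !≢0}}
  scaled : X * (Ua * Ub) * K ≡ Y * Uab * K
  scaled = begin
    X * (Ua * Ub) * K                                        ≡⟨ regroupˡ X Ua Ub (q ^ a) (q ^ b) (a !) (b !) ⟩
    X * ((q ^ a * a ! * Ua) * (q ^ b * b ! * Ub))            ≡⟨ cong₂ (λ s t → X * (s * t)) qa!≡ qb!≡ ⟨
    X * ((q * a) ! * (q * b) !)                              ≡⟨ binomial-factorial (q * a) (q * b) ⟩
    (q * a + q * b) !                                        ≡⟨ cong _! (*-distribˡ-+ q a b) ⟨
    (q * (a + b)) !                                          ≡⟨ qab!≡ ⟩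
    q ^ (a + b) * (a + b) ! * Uab                            ≡⟨ cong₂ (λ s t → s * t * Uab) (^-distribˡ-+-* q a b)
                                                                                        (sym (binomial-factorial a b)) ⟩
    q ^ a * q ^ b * (Y * (a ! * b !)) * Uab                  ≡⟨ regroupʳ (q ^ a) (q ^ b) Y (a ! * b !) Uab ⟩
    Y * Uab * K                                              ∎
    where
    regroupˡ : ∀ X U V Qa Qb A B → X * (U * V) * (Qa * Qb * (A * B)) ≡ X * ((Qa * A * U) * (Qb * B * V))
    regroupˡ = solve-∀
    regroupʳ : ∀ Qa Qb Y F U → Qa * Qb * (Y * F) * U ≡ Y * U * (Qa * Qb * F)
    regroupʳ = solve-∀

absorption : ∀ q′ k → let q = suc q′ ; n = suc k in q * ((q * n ∸ 1) C (n ∸ 1)) * (n ! * (q′ * n) !) ≡ (q * n) !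
absorption q′ k = begin
  q * A * (n ! * (q′ * n) !)             ≡⟨ regroup q A n (k !) ((q′ * n) !) ⟩
  q * n * (A * (k ! * (q′ * n) !))       ≡⟨ cong (q * n *_) (binomial-factorial k (q′ * n)) ⟩
  (q * n) !                              ∎
  where
  open ≡-Reasoning
  q = suc q′
  n = suc k
  A = (k + q′ * n) C k
  regroup : ∀ q A n K F → q * A * (n * K * F) ≡ q * n * (A * (K * F))
  regroup = solve-∀

catalan-exact : ∀ h m → m ! * suc (h * m) ! ∣ (suc h * m) ! → suc (h * m) * catalan h m ≡ (suc h * m) C m
catalan-exact h m landau-∣ = m*[n/m]≡n u∣B
  where
  u = suc (h * m)
  instance
    m![hm]!≢0 : NonZero (m ! * (h * m) !)
    m![hm]!≢0 = m !* (h * m) !≢0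
  u∣B : u ∣ (suc h * m) C m
  u∣B = *-cancelʳ-∣ (m ! * (h * m) !)
          (subst₂ _∣_ (regroup u (m !) ((h * m) !)) (sym (binomial-factorial m (h * m))) landau-∣)
    where
    regroup : ∀ u M H → M * (u * H) ≡ u * (M * H)
    regroup = solve-∀

catalan-factorial : ∀ h m → m ! * suc (h * m) ! ∣ (suc h * m) ! → catalan h m * (m ! * suc (h * m) !) ≡ (suc h * m) !
catalan-factorial h m landau-∣ = begin
  catalan h m * (m ! * (u * (h * m) !))       ≡⟨ regroup (catalan h m) u (m !) ((h * m) !) ⟩
  (u * catalan h m) * (m ! * (h * m) !)       ≡⟨ cong (_* (m ! * (h * m) !)) (catalan-exact h m landau-∣) ⟩
  ((suc h * m) C m) * (m ! * (h * m) !)       ≡⟨ binomial-factorial m (h * m) ⟩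
  (suc h * m) !                               ∎
  where
  open ≡-Reasoning
  u = suc (h * m)
  regroup : ∀ x u M H → x * (M * (u * H)) ≡ (u * x) * (M * H)
  regroup = solve-∀

-- Writing q A x = c w D, one gets
-- c w u U = q A V, so q ∣ c and hence w D ∣ A x.
cancelPrime : ∀ q A x w D u B U V .{{_ : NonZero D}} → Prime q → w * D ∣ q * A * x →
              u * x ≡ B → B * U ≡ D * V → ¬ q ∣ w → ¬ q ∣ u → ¬ q ∣ U → w * D ∣ A * x
cancelPrime q A x w D u B U V q-prime (divides c qAx≡cwD) ux≡B BU≡DV q∤w q∤u q∤U =
  conclude (euclidsLemma c (w * u * U) q-prime (divides (A * V) (trans cofactor (*-comm q (A * V)))))
  where
  open ≡-Reasoning
  instance
    q≢0 : NonZero q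
    q≢0 = prime⇒nonZero q-prime
  cofactor : c * (w * u * U) ≡ q * (A * V)
  cofactor = *-cancelˡ-≡ _ _ D (begin
    D * (c * (w * u * U))    ≡⟨ regroup₁ D c w u U ⟩
    c * (w * D) * (u * U)    ≡⟨ cong (_* (u * U)) qAx≡cwD ⟨
    q * A * x * (u * U)      ≡⟨ regroup₂ q A x u U ⟩
    q * A * (u * x) * U      ≡⟨ cong (λ y → q * A * y * U) ux≡B ⟩
    q * A * B * U            ≡⟨ *-assoc (q * A) B U ⟩
    q * A * (B * U)          ≡⟨ cong (q * A *_) BU≡DV ⟩
    q * A * (D * V)          ≡⟨ regroup₃ q A D V ⟩
    D * (q * (A * V))        ∎)
    where
    regroup₁ : ∀ D c w u U → D * (c * (w * u * U)) ≡ c * (w * D) * (u * U)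
    regroup₁ = solve-∀
    regroup₂ : ∀ q A x u U → q * A * x * (u * U) ≡ q * A * (u * x) * U
    regroup₂ = solve-∀
    regroup₃ : ∀ q A D V → q * A * (D * V) ≡ D * (q * (A * V))
    regroup₃ = solve-∀
  conclude : q ∣ c ⊎ q ∣ w * u * U → w * D ∣ A * x
  conclude (inj₂ q∣wuU) = ⊥-elim (Valuation.p∤* q q-prime (w * u) U (Valuation.p∤* q q-prime w u q∤w q∤u) q∤U q∣wuU)
  conclude (inj₁ (divides c′ c≡c′q)) = divides c′ (*-cancelˡ-≡ _ _ q (begin
    q * (A * x)              ≡⟨ *-assoc q A x ⟨
    q * A * x                ≡⟨ qAx≡cwD ⟩
    c * (w * D)              ≡⟨ cong (_* (w * D)) c≡c′q ⟩
    c′ * q * (w * D)         ≡⟨ regroup c′ q (w * D) ⟩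
    q * (c′ * (w * D))       ∎))
    where
    regroup : ∀ c q E → c * q * E ≡ q * (c * E)
    regroup = solve-∀

catalan-at : ∀ h q n → factorials (suc (h * q * n) ∷ q * n ∷ []) ∣ factorials (suc h * q * n ∷ []) →
  (suc (h * (q * n)) * catalan h (q * n) ≡ (suc h * (q * n)) C (q * n)) ×
  (catalan h (q * n) * ((q * n) ! * suc (h * q * n) !) ≡ (suc h * q * n) !)
catalan-at h q n landau-∣ =
  catalan-exact h m m!u!∣ ,
  subst₂ (λ a b → catalan h m * (m ! * suc a !) ≡ b !) (sym (*-assoc h q n)) (sym (*-assoc (suc h) q n))
         (catalan-factorial h m m!u!∣)
  where
  m = q * n
  swap : ∀ X Y → Y * (X * 1) ≡ X * Y
  swap = solve-∀
  m!u!∣ : m ! * suc (h * m) ! ∣ (suc h * m) !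
  m!u!∣ = subst₂ _∣_ (trans (cong (λ a → suc a ! * (m ! * 1)) (*-assoc h q n)) (swap (m !) (suc (h * m) !)))
                     (trans (*-identityʳ _) (cong _! (*-assoc (suc h) q n))) landau-∣

∣-cancel-common : ∀ a b M {N N′} .{{_ : NonZero N}} → a * M ≡ N → b * M ≡ N′ → N ∣ N′ → a ∣ b
∣-cancel-common a b M {N} aM≡N bM≡N′ N∣N′ = *-cancelʳ-∣ M {{M≢0}} (subst₂ _∣_ (sym aM≡N) (sym bM≡N′) N∣N′)
  where
  M≢0 : NonZero M
  M≢0 = ≢-nonZero λ M≡0 → ≢-nonZero⁻¹ N (trans (sym aM≡N) (trans (cong (a *_) M≡0) (*-zeroʳ a)))

-- For a prime q, a divisibility
--   w · C((h+1)n, n) ∣ q · A · C^{(h)}_{qn}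
-- loses its factor q when q ∤ w and q ∤ h(qn) + 1, because
-- (h(qn) + 1) C^{(h)}_{qn} = C((h+1)qn, qn) and C((h+1)n, n) have the same q-adic valuation.
removePrime : ∀ q h n w A → Prime q → factorials (suc (h * q * n) ∷ q * n ∷ []) ∣ factorials (suc h * q * n ∷ []) →
  w * ((suc h * n) C n) ∣ q * A * catalan h (q * n) → ¬ q ∣ w → ¬ q ∣ suc (h * (q * n)) →
  w * ((suc h * n) C n) ∣ A * catalan h (q * n)
removePrime q h n w A q-prime landau-∣ divisible q∤w q∤u with binomial-qpart q n (h * n) q-prime
... | U , V , BU≡DV , q∤U =
  cancelPrime q A (catalan h (q * n)) w ((suc h * n) C n) (suc (h * (q * n))) ((suc h * (q * n)) C (q * n)) U V
    {{binomial≢0 n (h * n)}} q-prime divisible (proj₁ (catalan-at h q n landau-∣))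
    (subst (λ a → (a C (q * n)) * U ≡ ((suc h * n) C n) * V) (regroup q h n) BU≡DV) q∤w q∤u q∤U
  where
  regroup : ∀ q h n → q * n + q * (h * n) ≡ suc h * (q * n)
  regroup = solve-∀

prime₃ : Prime 3
prime₃ = from-yes (prime? 3)

prime₅ : Prime 5
prime₅ = from-yes (prime? 5)

part₁-landau-step : ∀ k → let n = suc k in
  suc (6 * n) * ((5 * n) C n) ∣ 3 * ((3 * n ∸ 1) C (n ∸ 1)) * catalan 4 (3 * n)
part₁-landau-step k = ∣-cancel-common (w * D) (3 * A * x) M {{factorials≢0 L}} wDM≡ 3AxM≡ (part₁-landau n)
  where
  open ≡-Reasoning
  n = suc k
  A = (3 * n ∸ 1) C (n ∸ 1)
  x = catalan 4 (3 * n)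
  w = suc (6 * n)
  D = (5 * n) C n
  L = suc (12 * n) ∷ suc (6 * n) ∷ 2 * n ∷ 5 * n ∷ []
  F₁ = n !
  F₂ = (2 * n) !
  F₄ = (4 * n) !
  F₆ = (6 * n) !
  G₁₂ = suc (12 * n) !
  M = F₁ * F₂ * F₄ * F₆ * G₁₂
  wDM≡ : w * D * M ≡ factorials L
  wDM≡ = begin
    w * D * M                               ≡⟨ regroup₁ w D F₁ F₂ F₄ F₆ G₁₂ ⟩
    D * (F₁ * F₄) * (w * F₆) * F₂ * G₁₂     ≡⟨ cong (λ y → y * (w * F₆) * F₂ * G₁₂) (binomial-factorial n (4 * n)) ⟩
    (5 * n) ! * (w * F₆) * F₂ * G₁₂         ≡⟨ regroup₂ ((5 * n) !) (w * F₆) F₂ G₁₂ ⟩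
    factorials L                            ∎
    where
    regroup₁ : ∀ w D F₁ F₂ F₄ F₆ G → w * D * (F₁ * F₂ * F₄ * F₆ * G) ≡ D * (F₁ * F₄) * (w * F₆) * F₂ * G
    regroup₁ = solve-∀
    regroup₂ : ∀ F₅ G₆ F₂ G₁₂ → F₅ * G₆ * F₂ * G₁₂ ≡ G₁₂ * (G₆ * (F₂ * (F₅ * 1)))
    regroup₂ = solve-∀
  3AxM≡ : 3 * A * x * M ≡ factorials (15 * n ∷ 4 * n ∷ 6 * n ∷ [])
  3AxM≡ = begin
    3 * A * x * M                           ≡⟨ regroup₁ A x F₁ F₂ F₄ F₆ G₁₂ ⟩
    3 * A * (F₁ * F₂) * (x * G₁₂) * F₄ * F₆ ≡⟨ cong (λ y → y * (x * G₁₂) * F₄ * F₆) (absorption 2 k) ⟩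
    (3 * n) ! * (x * G₁₂) * F₄ * F₆         ≡⟨ regroup₂ ((3 * n) !) x G₁₂ F₄ F₆ ⟩
    x * ((3 * n) ! * G₁₂) * F₄ * F₆         ≡⟨ cong (λ y → y * F₄ * F₆) (proj₂ (catalan-at 4 3 n (catalan₄-landau n))) ⟩
    (15 * n) ! * F₄ * F₆                    ≡⟨ regroup₃ ((15 * n) !) F₄ F₆ ⟩
    factorials (15 * n ∷ 4 * n ∷ 6 * n ∷ []) ∎
    where
    regroup₁ : ∀ A x F₁ F₂ F₄ F₆ G → 3 * A * x * (F₁ * F₂ * F₄ * F₆ * G) ≡ 3 * A * (F₁ * F₂) * (x * G) * F₄ * F₆
    regroup₁ = solve-∀
    regroup₂ : ∀ F₃ x G F₄ F₆ → F₃ * (x * G) * F₄ * F₆ ≡ x * (F₃ * G) * F₄ * F₆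
    regroup₂ = solve-∀
    regroup₃ : ∀ F₁₅ F₄ F₆ → F₁₅ * F₄ * F₆ ≡ F₁₅ * (F₄ * (F₆ * 1))
    regroup₃ = solve-∀

part₂-landau-step : ∀ k → let n = suc k in
  (3 * n) C n ∣ 5 * ((5 * n ∸ 1) C (n ∸ 1)) * catalan 2 (5 * n)
part₂-landau-step k = ∣-cancel-common D (5 * A * x) M {{factorials≢0 L}} DM≡ 5AxM≡ (part₂-landau n)
  where
  open ≡-Reasoning
  n = suc k
  A = (5 * n ∸ 1) C (n ∸ 1)
  x = catalan 2 (5 * n)
  D = (3 * n) C n
  L = suc (10 * n) ∷ 4 * n ∷ 3 * n ∷ []
  F₁ = n !
  F₂ = (2 * n) !
  F₄ = (4 * n) !
  G₁₀ = suc (10 * n) !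
  M = F₁ * F₂ * F₄ * G₁₀
  DM≡ : D * M ≡ factorials L
  DM≡ = begin
    D * M                                   ≡⟨ *-assoc D _ G₁₀ ⟨
    D * (F₁ * F₂ * F₄) * G₁₀                ≡⟨ cong (_* G₁₀) (*-assoc D _ F₄) ⟨
    D * (F₁ * F₂) * F₄ * G₁₀                ≡⟨ cong (λ y → y * F₄ * G₁₀) (binomial-factorial n (2 * n)) ⟩
    (3 * n) ! * F₄ * G₁₀                    ≡⟨ regroup ((3 * n) !) F₄ G₁₀ ⟩
    factorials L                            ∎
    where
    regroup : ∀ F₃ F₄ G₁₀ → F₃ * F₄ * G₁₀ ≡ G₁₀ * (F₄ * (F₃ * 1))
    regroup = solve-∀
  5AxM≡ : 5 * A * x * M ≡ factorials (15 * n ∷ 2 * n ∷ [])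
  5AxM≡ = begin
    5 * A * x * M                           ≡⟨ regroup₁ A x F₁ F₂ F₄ G₁₀ ⟩
    5 * A * (F₁ * F₄) * (x * G₁₀) * F₂      ≡⟨ cong (λ y → y * (x * G₁₀) * F₂) (absorption 4 k) ⟩
    (5 * n) ! * (x * G₁₀) * F₂              ≡⟨ regroup₂ ((5 * n) !) x G₁₀ F₂ ⟩
    x * ((5 * n) ! * G₁₀) * F₂              ≡⟨ cong (_* F₂) (proj₂ (catalan-at 2 5 n (catalan₂-landau n))) ⟩
    (15 * n) ! * F₂                         ≡⟨ cong ((15 * n) ! *_) (*-identityʳ F₂) ⟨
    factorials (15 * n ∷ 2 * n ∷ [])        ∎
    where
    regroup₁ : ∀ A x F₁ F₂ F₄ G → 5 * A * x * (F₁ * F₂ * F₄ * G) ≡ 5 * A * (F₁ * F₄) * (x * G) * F₂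
    regroup₁ = solve-∀
    regroup₂ : ∀ F₅ x G F₂ → F₅ * (x * G) * F₂ ≡ x * (F₅ * G) * F₂
    regroup₂ = solve-∀

-- Each follows from its Landau step by removing the prime 3, resp. 5; the side
-- conditions are 3 ∤ 6n + 1, 3 ∤ 12n + 1, 5 ∤ 1 and 5 ∤ 10n + 1.
theorem1p3 : ∀ (k : ℕ) → let n = suc k in
    ((suc (6 * n)) * ((5 * n) C n) ∣ ((3 * n ∸ 1) C (n ∸ 1)) * catalan 4 (3 * n))
    × (((3 * n) C n) ∣ ((5 * n ∸ 1) C (n ∸ 1)) * catalan 2 (5 * n))
theorem1p3 k = first , second
  where
  n = suc k
  A₃ = (3 * n ∸ 1) C (n ∸ 1)
  A₅ = (5 * n ∸ 1) C (n ∸ 1)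
  2≤3 : 2 ≤ 3
  2≤3 = s≤s (s≤s z≤n)
  2≤5 : 2 ≤ 5
  2≤5 = s≤s (s≤s z≤n)
  first : suc (6 * n) * ((5 * n) C n) ∣ A₃ * catalan 4 (3 * n)
  first = removePrime 3 4 n (suc (6 * n)) A₃ prime₃ (catalan₄-landau n) (part₁-landau-step k)
                      (∤1+ 2≤3 (∣m⇒∣m*n n (divides 2 refl))) (∤1+ 2≤3 (∣n⇒∣m*n 4 (m∣m*n n)))
  second : (3 * n) C n ∣ A₅ * catalan 2 (5 * n)
  second = subst (_∣ A₅ * catalan 2 (5 * n)) (*-identityˡ ((3 * n) C n))
    (removePrime 5 2 n 1 A₅ prime₅ (catalan₂-landau n)
                 (subst (_∣ 5 * A₅ * catalan 2 (5 * n)) (sym (*-identityˡ ((3 * n) C n))) (part₂-landau-step k))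
                 (Valuation.p∤1 5 prime₅) (∤1+ 2≤5 (∣n⇒∣m*n 2 (m∣m*n n))))
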